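{- Writing $\nabla\Phi:=\,!?\Phi$, the PC-principle $\cdot\,\nabla\alpha\to\alpha$ is equivalent in QHC to the meta-conjunction of two items: the PC-rule $\nabla\alpha/\alpha$, and the R-principle $\cdot\,(\nabla\alpha\to\nabla\beta)\to\nabla(\alpha\to\beta)$. That is, each side is derivable in QHC from the other.
   Context: Meta-logical framework. Formulas of a first-order language may contain individual variables and predicate variables. Meta-formulas are built from formulas using meta-conjunction $\&$, meta-implication $\Rightarrow$, and universal meta-quantifiers over individual and predicate variables. A principle $\cdot G$, for a formula $G$, is the meta-formula obtained by universally meta-quantifying all free individual variables of $G$ and then all predicate variables of $G$. A rule $F_1,\dots,F_m/G$ is the meta-formula $\forall^2(\forall^1F_1\,\&\cdots\&\,\forall^1F_m\Rightarrow\forall^1G)$, where $\forall^1$ meta-quantifies the free individual variables of the formula it precedes and $\forall^2$ meta-quantifies all predicate variables occurring. A logic $L$ is given by a derivation system $\mathcal D$, a meta-conjunction of finitely many principles and rules. For a meta-formula $\mathcal F$, $\vdash_L\mathcal F$ means that $\mathcal D\Rightarrow\mathcal F$ is derivable by the natural-deduction meta-rules: introduction and elimination of $\&$, $\Rightarrow$ and the universal meta-quantifiers (elimination allows substituting terms for individual variables and formulas for predicate variables), plus $\alpha$-conversion. The notation $\mathcal F\vdash_L\mathcal G$ means $\vdash_L\mathcal F\Rightarrow\mathcal G$. Language of QHC. It has individual variables and, for each $n\ge0$, countably many $n$-ary problem variables $\alpha,\beta,\gamma,\delta,\theta,\dots$ and countably many $n$-ary proper predicate variables $p,q,\dots$.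 - A c-formula is $\top$, $\bot$, an atom $p(x_1,\dots,x_n)$, or $?\Phi$ for an i-formula $\Phi$, closed under the classical connectives $\land,\lor,\to,\leftrightarrow,\neg$ and quantifiers $\exists,\forall$. - An i-formula is $\checkmark$ (triviality), $\curlywedge$ (absurdity), an atom $\alpha(x_1,\dots,x_n)$, or $!F$ for a c-formula $F$, closed under the intuitionistic connectives $\land,\lor,\to,\leftrightarrow,\neg$ (with $\neg\Phi:=\Phi\to\curlywedge$) and quantifiers $\exists,\forall$. Connectives applied to c-formulas are classical; those applied to i-formulas are intuitionistic. QHC is the logic whose derivation system consists of: - (0a) all laws and rules of classical predicate logic QC, for c-formulas; - (0b) all laws and rules of intuitionistic predicate logic QH, for i-formulas; - the principles $\cdot\,?(\gamma\land\delta)\leftrightarrow ?\gamma\land ?\delta$, $\cdot\,?(\gamma\lor\delta)\leftrightarrow ?\gamma\lor ?\delta$, $\cdot\,?(\gamma\to\delta)\to(?\gamma\to ?\delta)$, $\cdot\,\neg ?\curlywedge$, $\cdot\,?\exists x\,\theta(x)\leftrightarrow\exists x\,?\theta(x)$, $\cdot\,?\forall x\,\theta(x)\to\forall x\,?\theta(x)$, $\cdot\,\gamma\to\,!?\gamma$, $\cdot\,\neg !\bot$, $\cdot\,?!p\to p$, $\cdot\,!p\to\,!?!p$ and $\cdot\,!(p\to q)\to(!p\to !q)$; - the rules $!p/p$ and $p/!p$. -}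

module Defs where

open import Data.Nat using (ℕ; zero; suc; _⊔_; _∸_)
open import Data.Product using (Σ; _×_; _,_)
open import Data.List using (List; []; _∷_; map; _++_)
open import Data.List.Membership.Propositional using (_∈_)
open import Data.Vec using (Vec; []; _∷_)
import Data.Vec as Vec
open import Function using (_∘_; id)

-- C : c-formulas (classical), I : i-formulas (intuitionistic)
data Sort : Set where
  C I : Sort

-- a predicate variable: its sort (C = proper predicate variable,
-- I = problem variable) and its arity
PV : Set
PV = Sort × ℕ

PCtx : Set
PCtx = List PV

data _∋_ : PCtx → PV → Set where
  here  : ∀ {Δ p} → (p ∷ Δ) ∋ p
  there : ∀ {Δ p q} → Δ ∋ p → (q ∷ Δ) ∋ p

-- Individual variables are de Bruijn indices (ℕ, unscoped,
-- so there are countably many individual variables available).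
-- Connectives are sort-generic: on sort C they are the classical ones,
-- on sort I the intuitionistic ones.
--   top : ⊤ (sort C) / ✓ (sort I);  bot : ⊥ (sort C) / ⋏ (sort I)
--   ¿ Φ : ?Φ ;  ¡ F : !F

infixr 6 _∧_
infixr 5 _∨_
infixr 4 _⟶_ _⟷_
infix  8 ¿_ ¡_ ¬_

data Fm (Δ : PCtx) : Sort → Set where
  top bot : ∀ {s} → Fm Δ s
  pv      : ∀ {s k} → Δ ∋ (s , k) → Vec ℕ k → Fm Δ s
  ¿_      : Fm Δ I → Fm Δ C
  ¡_      : Fm Δ C → Fm Δ I
  _∧_ _∨_ _⟶_ : ∀ {s} → Fm Δ s → Fm Δ s → Fm Δ s
  ∃̇ ∀̇    : ∀ {s} → Fm Δ s → Fm Δ s      -- binds variable 0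

¬_ : ∀ {Δ s} → Fm Δ s → Fm Δ s
¬ F = F ⟶ bot

_⟷_ : ∀ {Δ s} → Fm Δ s → Fm Δ s → Fm Δ s
F ⟷ G = (F ⟶ G) ∧ (G ⟶ F)

ext : (ℕ → ℕ) → ℕ → ℕ
ext ρ zero    = zero
ext ρ (suc i) = suc (ρ i)

renF : ∀ {Δ s} → (ℕ → ℕ) → Fm Δ s → Fm Δ s
renF ρ top       = top
renF ρ bot       = bot
renF ρ (pv x ts) = pv x (Vec.map ρ ts)
renF ρ (¿ F)     = ¿ renF ρ F
renF ρ (¡ F)     = ¡ renF ρ F
renF ρ (F ∧ G)   = renF ρ F ∧ renF ρ G
renF ρ (F ∨ G)   = renF ρ F ∨ renF ρ G
renF ρ (F ⟶ G)   = renF ρ F ⟶ renF ρ G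
renF ρ (∃̇ F)     = ∃̇ (renF (ext ρ) F)
renF ρ (∀̇ F)     = ∀̇ (renF (ext ρ) F)

PRen : PCtx → PCtx → Set
PRen Δ Δ' = ∀ {p} → Δ ∋ p → Δ' ∋ p

liftR : ∀ {Δ Δ' q} → PRen Δ Δ' → PRen (q ∷ Δ) (q ∷ Δ')
liftR r here      = here
liftR r (there x) = there (r x)

renPF : ∀ {Δ Δ' s} → PRen Δ Δ' → Fm Δ s → Fm Δ' s
renPF r top       = top
renPF r bot       = bot
renPF r (pv x ts) = pv (r x) ts
renPF r (¿ F)     = ¿ renPF r F
renPF r (¡ F)     = ¡ renPF r F
renPF r (F ∧ G)   = renPF r F ∧ renPF r G
renPF r (F ∨ G)   = renPF r F ∨ renPF r G
renPF r (F ⟶ G)   = renPF r F ⟶ renPF r G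
renPF r (∃̇ F)     = ∃̇ (renPF r F)
renPF r (∀̇ F)     = ∀̇ (renPF r F)

-- A substitution
-- gives, for a predicate variable of sort s and arity k, the formula to
-- put in place of an atom with argument list ts, given the embedding ρ
-- of the outer individual variables into the current scope (this makes
-- the substitution capture-avoiding under object binders).

PSub : PCtx → PCtx → Set
PSub Δ Δ' = ∀ {s k} → Δ ∋ (s , k) → (ℕ → ℕ) → Vec ℕ k → Fm Δ' s

subF : ∀ {Δ Δ' s} → PSub Δ Δ' → (ℕ → ℕ) → Fm Δ s → Fm Δ' s
subF σ ρ top       = top
subF σ ρ bot       = bot
subF σ ρ (pv x ts) = σ x ρ ts
subF σ ρ (¿ F)     = ¿ subF σ ρ F
subF σ ρ (¡ F)     = ¡ subF σ ρ F
subF σ ρ (F ∧ G)   = subF σ ρ F ∧ subF σ ρ G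
subF σ ρ (F ∨ G)   = subF σ ρ F ∨ subF σ ρ G
subF σ ρ (F ⟶ G)   = subF σ ρ F ⟶ subF σ ρ G
subF σ ρ (∃̇ F)     = ∃̇ (subF σ (suc ∘ ρ) F)
subF σ ρ (∀̇ F)     = ∀̇ (subF σ (suc ∘ ρ) F)

liftS : ∀ {Δ Δ' q} → PSub Δ Δ' → PSub (q ∷ Δ) (q ∷ Δ')
liftS σ here      ρ ts = pv here ts
liftS σ (there x) ρ ts = renPF there (σ x ρ ts)

-- A formula Φ substituted for a k-ary predicate variable: variables
-- 0..k-1 of Φ are the argument places x₁..x_k, variable k+j of Φ is
-- the (outer) individual variable j.
env : ∀ {k} → Vec ℕ k → (ℕ → ℕ) → ℕ → ℕ
env []       ρ j       = ρ j
env (t ∷ ts) ρ zero    = t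
env (t ∷ ts) ρ (suc j) = env ts ρ j

inst : ∀ {Δ s k} → Fm Δ s → PSub ((s , k) ∷ Δ) Δ
inst Φ here      ρ ts = renF (env ts ρ) Φ
inst Φ (there x) ρ ts = pv x ts

infixr 3 _&_
infixr 2 _⟹_

data MF (Δ : PCtx) : Set where
  ⌜_⌝  : ∀ {s} → Fm Δ s → MF Δ
  _&_  : MF Δ → MF Δ → MF Δ
  _⟹_  : MF Δ → MF Δ → MF Δ
  Π¹   : MF Δ → MF Δ                               -- ∀ over individual var 0
  Π²   : (s : Sort) (k : ℕ) → MF ((s , k) ∷ Δ) → MF Δ  -- ∀ over a predicate var

renM : ∀ {Δ} → (ℕ → ℕ) → MF Δ → MF Δ
renM ρ ⌜ F ⌝      = ⌜ renF ρ F ⌝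
renM ρ (M & N)    = renM ρ M & renM ρ N
renM ρ (M ⟹ N)    = renM ρ M ⟹ renM ρ N
renM ρ (Π¹ M)     = Π¹ (renM (ext ρ) M)
renM ρ (Π² s k M) = Π² s k (renM ρ M)

renPM : ∀ {Δ Δ'} → PRen Δ Δ' → MF Δ → MF Δ'
renPM r ⌜ F ⌝      = ⌜ renPF r F ⌝
renPM r (M & N)    = renPM r M & renPM r N
renPM r (M ⟹ N)    = renPM r M ⟹ renPM r N
renPM r (Π¹ M)     = Π¹ (renPM r M)
renPM r (Π² s k M) = Π² s k (renPM (liftR r) M)

subM : ∀ {Δ Δ'} → PSub Δ Δ' → (ℕ → ℕ) → MF Δ → MF Δ'
subM σ ρ ⌜ F ⌝      = ⌜ subF σ ρ F ⌝
subM σ ρ (M & N)    = subM σ ρ M & subM σ ρ N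
subM σ ρ (M ⟹ N)    = subM σ ρ M ⟹ subM σ ρ N
subM σ ρ (Π¹ M)     = Π¹ (subM σ (suc ∘ ρ) M)
subM σ ρ (Π² s k M) = Π² s k (subM (liftS σ) ρ M)

inst1 : ℕ → ℕ → ℕ
inst1 t zero    = t
inst1 t (suc i) = i

-- Natural deduction for meta-formulas (α-conversion is built in by
-- the de Bruijn representation).

data Der : (Δ : PCtx) → List (MF Δ) → MF Δ → Set where
  hyp  : ∀ {Δ Γ M} → M ∈ Γ → Der Δ Γ M
  &I   : ∀ {Δ Γ M N} → Der Δ Γ M → Der Δ Γ N → Der Δ Γ (M & N)
  &E₁  : ∀ {Δ Γ M N} → Der Δ Γ (M & N) → Der Δ Γ M
  &E₂  : ∀ {Δ Γ M N} → Der Δ Γ (M & N) → Der Δ Γ N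
  ⟹I   : ∀ {Δ Γ M N} → Der Δ (M ∷ Γ) N → Der Δ Γ (M ⟹ N)
  ⟹E   : ∀ {Δ Γ M N} → Der Δ Γ (M ⟹ N) → Der Δ Γ M → Der Δ Γ N
  Π¹I  : ∀ {Δ Γ M} → Der Δ (map (renM suc) Γ) M → Der Δ Γ (Π¹ M)
  Π¹E  : ∀ {Δ Γ M} → Der Δ Γ (Π¹ M) → (t : ℕ) → Der Δ Γ (renM (inst1 t) M)
  Π²I  : ∀ {Δ Γ s k M} → Der ((s , k) ∷ Δ) (map (renPM there) Γ) M
       → Der Δ Γ (Π² s k M)
  Π²E  : ∀ {Δ Γ s k M} → Der Δ Γ (Π² s k M) → (Φ : Fm Δ s)
       → Der Δ Γ (subM (inst {k = k} Φ) id M)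

-- an upper bound on free individual variables: all free vars are < fvb F
maxV : ∀ {k} → Vec ℕ k → ℕ
maxV []       = 0
maxV (t ∷ ts) = suc t ⊔ maxV ts

fvb : ∀ {Δ s} → Fm Δ s → ℕ
fvb top       = 0
fvb bot       = 0
fvb (pv x ts) = maxV ts
fvb (¿ F)     = fvb F
fvb (¡ F)     = fvb F
fvb (F ∧ G)   = fvb F ⊔ fvb G
fvb (F ∨ G)   = fvb F ⊔ fvb G
fvb (F ⟶ G)   = fvb F ⊔ fvb G
fvb (∃̇ F)     = fvb F ∸ 1
fvb (∀̇ F)     = fvb F ∸ 1

Π¹ⁿ : ∀ {Δ} → ℕ → MF Δ → MF Δ
Π¹ⁿ zero    M = M
Π¹ⁿ (suc n) M = Π¹ (Π¹ⁿ n M)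

∀¹ : ∀ {Δ s} → Fm Δ s → MF Δ
∀¹ F = Π¹ⁿ (fvb F) ⌜ F ⌝

∀² : ∀ {Δ} → MF Δ → MF []
∀² {[]}          M = M
∀² {(s , k) ∷ Δ} M = ∀² {Δ} (Π² s k M)

principle : ∀ {Δ s} → Fm Δ s → MF []
principle G = ∀² (∀¹ G)

record SFm (Δ : PCtx) : Set where
  constructor [_]
  field {srt} : Sort
        fm    : Fm Δ srt

∀¹' : ∀ {Δ} → SFm Δ → MF Δ
∀¹' [ F ] = ∀¹ F

conj : ∀ {Δ} → MF Δ → List (MF Δ) → MF Δ
conj M []       = M
conj M (N ∷ Ns) = M & conj N Ns

rule : ∀ {Δ} → SFm Δ → List (SFm Δ) → SFm Δ → MF []
rule F₁ Fs G = ∀² (conj (∀¹' F₁) (map ∀¹' Fs) ⟹ ∀¹' G)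

-- a logic is given by a derivation system: a (nonempty) finite
-- meta-conjunction of principles and rules
record Logic : Set where
  constructor logic
  field
    ax₁  : MF []
    axs  : List (MF [])

𝒟 : Logic → MF []
𝒟 (logic a as) = conj a as

⊢⟨_⟩_ : Logic → MF [] → Set
⊢⟨ L ⟩ M = Der [] [] (𝒟 L ⟹ M)

_⊢⟨_⟩_ : MF [] → Logic → MF [] → Set
M ⊢⟨ L ⟩ N = ⊢⟨ L ⟩ (M ⟹ N)

v₀ : ∀ {p Δ} → (p ∷ Δ) ∋ p
v₀ = here
v₁ : ∀ {p q Δ} → (q ∷ p ∷ Δ) ∋ p
v₁ = there here
v₂ : ∀ {p q r Δ} → (r ∷ q ∷ p ∷ Δ) ∋ p
v₂ = there (there here)

-- Hilbert-style axiomatization of intuitionistic predicate logic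
-- (Kleene), as principles and rules, for formulas of sort s.
hilbert : Sort → List (MF [])
hilbert s =
    principle {Δ3} (P ⟶ (Q ⟶ P))
  ∷ principle {Δ3} ((P ⟶ Q) ⟶ ((P ⟶ (Q ⟶ R)) ⟶ (P ⟶ R)))
  ∷ principle {Δ3} (P ⟶ (Q ⟶ (P ∧ Q)))
  ∷ principle {Δ3} ((P ∧ Q) ⟶ P)
  ∷ principle {Δ3} ((P ∧ Q) ⟶ Q)
  ∷ principle {Δ3} (P ⟶ (P ∨ Q))
  ∷ principle {Δ3} (Q ⟶ (P ∨ Q))
  ∷ principle {Δ3} ((P ⟶ R) ⟶ ((Q ⟶ R) ⟶ ((P ∨ Q) ⟶ R)))
  ∷ principle {Δ3} ((P ⟶ Q) ⟶ ((P ⟶ ¬ Q) ⟶ ¬ P))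
  ∷ principle {Δ3} (bot ⟶ P)
  ∷ principle {Δ3} (top {Δ3} {s})
  ∷ principle {Δq} (∀̇ (U 0) ⟶ U 0)          -- ∀x p(x) → p(y)
  ∷ principle {Δq} (U 0 ⟶ ∃̇ (U 0))          -- p(y) → ∃x p(x)
  ∷ rule {Δ3} [ P ] ([ P ⟶ Q ] ∷ []) [ Q ]
  ∷ rule {Δq} [ Q0 ⟶ U 0 ] [] [ Q0 ⟶ ∀̇ (U 0) ]   -- q → p(x) / q → ∀x p(x)
  ∷ rule {Δq} [ U 0 ⟶ Q0 ] [] [ ∃̇ (U 0) ⟶ Q0 ]   -- p(x) → q / ∃x p(x) → q
  ∷ []
  where
    Δ3 : PCtx
    Δ3 = (s , 0) ∷ (s , 0) ∷ (s , 0) ∷ []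
    P Q R : Fm Δ3 s
    P = pv v₀ []
    Q = pv v₁ []
    R = pv v₂ []
    Δq : PCtx
    Δq = (s , 1) ∷ (s , 0) ∷ []
    U : ℕ → Fm Δq s
    U x = pv v₀ (x ∷ [])
    Q0 : Fm Δq s
    Q0 = pv v₁ []

QC-system : List (MF [])
QC-system = hilbert C ++ (principle {(C , 0) ∷ []} (¬ ¬ pv v₀ [] ⟶ pv v₀ []) ∷ [])

QH-system : List (MF [])
QH-system = hilbert I

QHC-specific : List (MF [])
QHC-specific =
    principle {ΔI2} (¿ (γ ∧ δ) ⟷ (¿ γ ∧ ¿ δ))
  ∷ principle {ΔI2} (¿ (γ ∨ δ) ⟷ (¿ γ ∨ ¿ δ))
  ∷ principle {ΔI2} (¿ (γ ⟶ δ) ⟶ (¿ γ ⟶ ¿ δ))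
  ∷ principle {[]} (¬ ¿ bot)
  ∷ principle {Δθ} (¿ ∃̇ (θ 0) ⟷ ∃̇ (¿ θ 0))
  ∷ principle {Δθ} (¿ ∀̇ (θ 0) ⟶ ∀̇ (¿ θ 0))
  ∷ principle {ΔI2} (γ ⟶ ¡ ¿ γ)
  ∷ principle {[]} (¬ ¡ bot)
  ∷ principle {ΔC2} (¿ ¡ p ⟶ p)
  ∷ principle {ΔC2} (¡ p ⟶ ¡ ¿ ¡ p)
  ∷ principle {ΔC2} (¡ (p ⟶ q) ⟶ (¡ p ⟶ ¡ q))
  ∷ rule {ΔC2} [ ¡ p ] [] [ p ]
  ∷ rule {ΔC2} [ p ] [] [ ¡ p ]
  ∷ []
  where
    ΔI2 ΔC2 Δθ : PCtx
    ΔI2 = (I , 0) ∷ (I , 0) ∷ []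
    ΔC2 = (C , 0) ∷ (C , 0) ∷ []
    Δθ  = (I , 1) ∷ []
    γ δ : Fm ΔI2 I
    γ = pv v₀ []
    δ = pv v₁ []
    p q : Fm ΔC2 C
    p = pv v₀ []
    q = pv v₁ []
    θ : ℕ → Fm Δθ I
    θ x = pv v₀ (x ∷ [])

QHC : Logic
QHC = logic (principle {[]} (top {[]} {C})) (QC-system ++ QH-system ++ QHC-specific)

∇ : ∀ {Δ} → Fm Δ I → Fm Δ I
∇ Φ = ¡ ¿ Φ

private
  Δα Δαβ : PCtx
  Δα  = (I , 0) ∷ []
  Δαβ = (I , 0) ∷ (I , 0) ∷ []

PC-principle : MF []
PC-principle = principle {Δα} (∇ (pv v₀ []) ⟶ pv v₀ [])

PC-rule : MF []
PC-rule = rule {Δα} [ ∇ (pv v₀ []) ] [] [ pv v₀ [] ]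

R-principle : MF []
R-principle = principle {Δαβ} ((∇ α ⟶ ∇ β) ⟶ ∇ (α ⟶ β))
  where
    α β : Fm Δαβ I
    α = pv v₀ []
    β = pv v₁ []

-- From PC: α → ∇α, so ∇α → ∇β yields α → ∇β, and PC turns this into
-- α → β, whence ∇(α → β); the PC-rule is modus ponens with PC.
-- Conversely ?!p → p at p := ?α, made an !-formula by the rule p/!p and
-- distributed over !, gives ∇∇α → ∇α; the R-principle for (∇α, α) turns
-- this into ∇(∇α → α), and the PC-rule removes the ∇.
module Submission where

open import Defs
open import Data.Fin using (Fin; #_)
open import Data.List using (List; []; _∷_; length; lookup)
open import Data.List.Membership.Propositional using (_∈_)
open import Data.List.Membership.Propositional.Properties using (∈-lookup; ∈-++⁺ˡ; ∈-++⁺ʳ)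
open import Data.List.Relation.Unary.Any using (here; there)
open import Data.Nat using (ℕ; zero; suc)
open import Data.Product using (_×_; _,_)
open import Data.Vec using ([])
open import Data.Vec.Properties using (map-cong; map-id)
open import Function using (id)
open import Relation.Binary.PropositionalEquality

ext-id : {ρ : ℕ → ℕ} → ρ ≗ id → ext ρ ≗ id
ext-id ρ≗id zero    = refl
ext-id ρ≗id (suc i) = cong suc (ρ≗id i)

renF-id : ∀ {Δ s} {ρ : ℕ → ℕ} → ρ ≗ id → (F : Fm Δ s) → renF ρ F ≡ F
renF-id ρ≗id top       = refl
renF-id ρ≗id bot       = refl
renF-id ρ≗id (pv x ts) = cong (pv x) (trans (map-cong ρ≗id ts) (map-id ts))
renF-id ρ≗id (¿ F)     = cong ¿_ (renF-id ρ≗id F)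
renF-id ρ≗id (¡ F)     = cong ¡_ (renF-id ρ≗id F)
renF-id ρ≗id (F ∧ G)   = cong₂ _∧_ (renF-id ρ≗id F) (renF-id ρ≗id G)
renF-id ρ≗id (F ∨ G)   = cong₂ _∨_ (renF-id ρ≗id F) (renF-id ρ≗id G)
renF-id ρ≗id (F ⟶ G)   = cong₂ _⟶_ (renF-id ρ≗id F) (renF-id ρ≗id G)
renF-id ρ≗id (∃̇ F)     = cong ∃̇ (renF-id (ext-id ρ≗id) F)
renF-id ρ≗id (∀̇ F)     = cong ∀̇ (renF-id (ext-id ρ≗id) F)

renPF-id : ∀ {Δ s} (F : Fm Δ s) → renPF (λ x → x) F ≡ F
renPF-id top       = refl
renPF-id bot       = refl
renPF-id (pv x ts) = refl
renPF-id (¿ F)     = cong ¿_ (renPF-id F)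
renPF-id (¡ F)     = cong ¡_ (renPF-id F)
renPF-id (F ∧ G)   = cong₂ _∧_ (renPF-id F) (renPF-id G)
renPF-id (F ∨ G)   = cong₂ _∨_ (renPF-id F) (renPF-id G)
renPF-id (F ⟶ G)   = cong₂ _⟶_ (renPF-id F) (renPF-id G)
renPF-id (∃̇ F)     = cong ∃̇ (renPF-id F)
renPF-id (∀̇ F)     = cong ∀̇ (renPF-id F)

renPF-∘ : ∀ {Δ Δ' Δ'' s} (r' : PRen Δ' Δ'') (r : PRen Δ Δ') (F : Fm Δ s)
        → renPF r' (renPF r F) ≡ renPF (λ x → r' (r x)) F
renPF-∘ r' r top       = refl
renPF-∘ r' r bot       = refl
renPF-∘ r' r (pv x ts) = refl
renPF-∘ r' r (¿ F)     = cong ¿_ (renPF-∘ r' r F)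
renPF-∘ r' r (¡ F)     = cong ¡_ (renPF-∘ r' r F)
renPF-∘ r' r (F ∧ G)   = cong₂ _∧_ (renPF-∘ r' r F) (renPF-∘ r' r G)
renPF-∘ r' r (F ∨ G)   = cong₂ _∨_ (renPF-∘ r' r F) (renPF-∘ r' r G)
renPF-∘ r' r (F ⟶ G)   = cong₂ _⟶_ (renPF-∘ r' r F) (renPF-∘ r' r G)
renPF-∘ r' r (∃̇ F)     = cong ∃̇ (renPF-∘ r' r F)
renPF-∘ r' r (∀̇ F)     = cong ∀̇ (renPF-∘ r' r F)

subF-renPF : ∀ {Δ Δ' Δ''} (σ : PSub Δ' Δ'') (r : PRen Δ Δ') (r' : PRen Δ Δ'')
           → (∀ {s k} (x : Δ ∋ (s , k)) ρ ts → σ (r x) ρ ts ≡ pv (r' x) ts)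
           → ∀ {s} ρ (F : Fm Δ s) → subF σ ρ (renPF r F) ≡ renPF r' F
subF-renPF σ r r' σr≡r' ρ top       = refl
subF-renPF σ r r' σr≡r' ρ bot       = refl
subF-renPF σ r r' σr≡r' ρ (pv x ts) = σr≡r' x ρ ts
subF-renPF σ r r' σr≡r' ρ (¿ F)     = cong ¿_ (subF-renPF σ r r' σr≡r' ρ F)
subF-renPF σ r r' σr≡r' ρ (¡ F)     = cong ¡_ (subF-renPF σ r r' σr≡r' ρ F)
subF-renPF σ r r' σr≡r' ρ (F ∧ G)   = cong₂ _∧_ (subF-renPF σ r r' σr≡r' ρ F) (subF-renPF σ r r' σr≡r' ρ G)
subF-renPF σ r r' σr≡r' ρ (F ∨ G)   = cong₂ _∨_ (subF-renPF σ r r' σr≡r' ρ F) (subF-renPF σ r r' σr≡r' ρ G)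
subF-renPF σ r r' σr≡r' ρ (F ⟶ G)   = cong₂ _⟶_ (subF-renPF σ r r' σr≡r' ρ F) (subF-renPF σ r r' σr≡r' ρ G)
subF-renPF σ r r' σr≡r' ρ (∃̇ F)     = cong ∃̇ (subF-renPF σ r r' σr≡r' _ F)
subF-renPF σ r r' σr≡r' ρ (∀̇ F)     = cong ∀̇ (subF-renPF σ r r' σr≡r' _ F)

-- Instantiating the meta-quantifiers of a principle over 0-ary variables
-- with ..., D, B, A (outermost first) replaces its variables here,
-- there here and there (there here) by the following formulas.

inst-var₀ : ∀ {Δ s} (A : Fm Δ s) → inst {k = 0} A here id [] ≡ A
inst-var₀ = renF-id (λ _ → refl)

inst-var₁ : ∀ {Δ s s'} (B : Fm Δ s) (A : Fm Δ s')
          → subF (inst {k = 0} A) id (renPF there (inst {k = 0} B here id [])) ≡ B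
inst-var₁ B A = begin
  subF (inst A) id (renPF there (inst B here id []))  ≡⟨ subF-renPF (inst A) there (λ x → x) (λ _ _ _ → refl) id _ ⟩
  renPF (λ x → x) (inst B here id [])                 ≡⟨ renPF-id _ ⟩
  inst B here id []                                   ≡⟨ inst-var₀ B ⟩
  B                                                   ∎
  where open ≡-Reasoning

inst-var₂ : ∀ {Δ s s' s''} (D : Fm Δ s) (B : Fm Δ s') (A : Fm Δ s'')
          → subF (inst {k = 0} A) id
              (subF (liftS (inst {k = 0} B)) id (renPF there (renPF there (inst {k = 0} D here id []))))
            ≡ D
inst-var₂ {Δ} {s} D B A = begin
  subF (inst A) id (subF (liftS (inst B)) id (renPF there (renPF there D₀)))
    ≡⟨ cong (λ F → subF (inst A) id (subF (liftS (inst B)) id F)) (renPF-∘ there there D₀) ⟩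
  subF (inst A) id (subF (liftS (inst B)) id (renPF (λ x → there (there x)) D₀))
    ≡⟨ cong (subF (inst A) id) (subF-renPF (liftS (inst B)) _ there (λ _ _ _ → refl) id D₀) ⟩
  subF (inst A) id (renPF there D₀)
    ≡⟨ inst-var₁ D A ⟩
  D ∎
  where
    open ≡-Reasoning
    D₀ : Fm Δ s
    D₀ = inst {k = 0} D here id []

conj-∈ : ∀ {Δ₀ Δ Γ} (r : PRen Δ₀ Δ) {M N : MF Δ₀} {Ns : List (MF Δ₀)}
       → M ∈ N ∷ Ns → Der Δ Γ (renPM r (conj N Ns)) → Der Δ Γ (renPM r M)
conj-∈ r {Ns = []}    (here refl) d = d
conj-∈ r {Ns = _ ∷ _} (here refl) d = &E₁ d
conj-∈ r {Ns = _ ∷ _} (there M∈) d = conj-∈ r M∈ (&E₂ d)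

module QHC-Reasoning {Δ : PCtx} {Γ : List (MF Δ)} (r : PRen [] Δ)
                     (𝒟-hyp : Der Δ Γ (renPM r (𝒟 QHC))) where

  infix 1 ⊢_

  ⊢_ : ∀ {s} → Fm Δ s → Set
  ⊢ F = Der Δ Γ ⌜ F ⌝

  private
    law : {M : MF []} → M ∈ Logic.axs QHC → Der Δ Γ (renPM r M)
    law M∈ = conj-∈ r {N = Logic.ax₁ QHC} {Ns = Logic.axs QHC} (there M∈) 𝒟-hyp

    QH-law : (i : Fin (length QH-system)) → Der Δ Γ (renPM r (lookup QH-system i))
    QH-law i = law (∈-++⁺ʳ QC-system (∈-++⁺ˡ {ys = QHC-specific} (∈-lookup {xs = QH-system} i)))

    QHC-law : (i : Fin (length QHC-specific)) → Der Δ Γ (renPM r (lookup QHC-specific i))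
    QHC-law i = law (∈-++⁺ʳ QC-system (∈-++⁺ʳ QH-system (∈-lookup {xs = QHC-specific} i)))

  -- Every law is meta-quantified over all variables of its context; those
  -- that do not occur in it are instantiated by top.

  mp : {A B : Fm Δ I} → ⊢ A → ⊢ A ⟶ B → ⊢ B
  mp {A} {B} ⊢A ⊢A⟶B =
    ⟹E (subst (Der Δ Γ) (cong₂ (λ X Y → ⌜ X ⌝ & ⌜ X ⟶ Y ⌝ ⟹ ⌜ Y ⌝) (inst-var₀ A) (inst-var₁ B A))
                        (Π²E (Π²E (Π²E (QH-law (# 13)) top) B) A))
       (&I ⊢A ⊢A⟶B)

  axK : (A B : Fm Δ I) → ⊢ A ⟶ (B ⟶ A)
  axK A B = subst (Der Δ Γ) (cong₂ (λ X Y → ⌜ X ⟶ (Y ⟶ X) ⌝) (inst-var₀ A) (inst-var₁ B A))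
                  (Π²E (Π²E (Π²E (QH-law (# 0)) top) B) A)

  axS : (A B D : Fm Δ I) → ⊢ (A ⟶ B) ⟶ ((A ⟶ (B ⟶ D)) ⟶ (A ⟶ D))
  axS A B D = subst (Der Δ Γ) (cong₃ (inst-var₀ A) (inst-var₁ B A) (inst-var₂ D B A))
                    (Π²E (Π²E (Π²E (QH-law (# 1)) D) B) A)
    where
      cong₃ : ∀ {a a' b b' c c'} → a ≡ a' → b ≡ b' → c ≡ c'
            → ⌜ (a ⟶ b) ⟶ ((a ⟶ (b ⟶ c)) ⟶ (a ⟶ c)) ⌝ ≡ ⌜ (a' ⟶ b') ⟶ ((a' ⟶ (b' ⟶ c')) ⟶ (a' ⟶ c')) ⌝
      cong₃ refl refl refl = refl

  ∇-unit : (A : Fm Δ I) → ⊢ A ⟶ ∇ A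
  ∇-unit A = subst (Der Δ Γ) (cong (λ X → ⌜ X ⟶ ∇ X ⌝) (inst-var₀ A))
                   (Π²E (Π²E (QHC-law (# 6)) top) A)

  ¿¡-elim : (F : Fm Δ C) → ⊢ ¿ ¡ F ⟶ F
  ¿¡-elim F = subst (Der Δ Γ) (cong (λ X → ⌜ ¿ ¡ X ⟶ X ⌝) (inst-var₀ F))
                    (Π²E (Π²E (QHC-law (# 8)) top) F)

  ¡-distrib : (F G : Fm Δ C) → ⊢ ¡ (F ⟶ G) ⟶ (¡ F ⟶ ¡ G)
  ¡-distrib F G = subst (Der Δ Γ) (cong₂ (λ X Y → ⌜ ¡ (X ⟶ Y) ⟶ (¡ X ⟶ ¡ Y) ⌝) (inst-var₀ F) (inst-var₁ G F))
                        (Π²E (Π²E (QHC-law (# 10)) G) F)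

  ¡-intro : {F : Fm Δ C} → ⊢ F → ⊢ ¡ F
  ¡-intro {F} = ⟹E (subst (Der Δ Γ) (cong (λ X → ⌜ X ⌝ ⟹ ⌜ ¡ X ⌝) (inst-var₀ F))
                                   (Π²E (Π²E (QHC-law (# 12)) top) F))

  ⟶-const : {A B : Fm Δ I} → ⊢ B → ⊢ A ⟶ B
  ⟶-const {A} {B} ⊢B = mp ⊢B (axK B A)

  ⟶-S : {A B D : Fm Δ I} → ⊢ A ⟶ B → ⊢ A ⟶ (B ⟶ D) → ⊢ A ⟶ D
  ⟶-S {A} {B} {D} ⊢A⟶B ⊢A⟶B⟶D = mp ⊢A⟶B⟶D (mp ⊢A⟶B (axS A B D))

  ⟶-trans : {A B D : Fm Δ I} → ⊢ A ⟶ B → ⊢ B ⟶ D → ⊢ A ⟶ D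
  ⟶-trans ⊢A⟶B ⊢B⟶D = ⟶-S ⊢A⟶B (⟶-const ⊢B⟶D)

  ⟶-precompose : {A B D : Fm Δ I} → ⊢ A ⟶ B → ⊢ (B ⟶ D) ⟶ (A ⟶ D)
  ⟶-precompose {A} {B} {D} ⊢A⟶B =
    ⟶-S (axK (B ⟶ D) A) (⟶-S (⟶-const ⊢A⟶B) (⟶-const (axS A B D)))

  ⟶-postcompose : {A B D : Fm Δ I} → ⊢ B ⟶ D → ⊢ (A ⟶ B) ⟶ (A ⟶ D)
  ⟶-postcompose {A} {B} {D} ⊢B⟶D = ⟶-S (⟶-const (⟶-const ⊢B⟶D)) (axS A B D)

  ∇∇-elim : (A : Fm Δ I) → ⊢ ∇ (∇ A) ⟶ ∇ A
  ∇∇-elim A = mp (¡-intro (¿¡-elim (¿ A))) (¡-distrib (¿ ∇ A) (¿ A))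

  PC⇒R : (∀ A → ⊢ ∇ A ⟶ A) → ∀ A B → ⊢ (∇ A ⟶ ∇ B) ⟶ ∇ (A ⟶ B)
  PC⇒R pc A B =
    ⟶-trans (⟶-trans (⟶-precompose (∇-unit A)) (⟶-postcompose (pc B))) (∇-unit (A ⟶ B))

  PC-rule&R⇒PC : (∀ {A} → ⊢ ∇ A → ⊢ A) → (∀ A B → ⊢ (∇ A ⟶ ∇ B) ⟶ ∇ (A ⟶ B))
               → ∀ A → ⊢ ∇ A ⟶ A
  PC-rule&R⇒PC pc-rule R A = pc-rule (mp (∇∇-elim A) (R (∇ A) A))

module SchemaInstances {Δ : PCtx} {Γ : List (MF Δ)} (r : PRen [] Δ) where

  PC-principle-instance : Der Δ Γ (renPM r PC-principle) → (A : Fm Δ I) → Der Δ Γ ⌜ ∇ A ⟶ A ⌝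
  PC-principle-instance pc A = subst (Der Δ Γ) (cong (λ X → ⌜ ∇ X ⟶ X ⌝) (inst-var₀ A)) (Π²E pc A)

  PC-rule-instance : Der Δ Γ (renPM r PC-rule) → {A : Fm Δ I} → Der Δ Γ ⌜ ∇ A ⌝ → Der Δ Γ ⌜ A ⌝
  PC-rule-instance pc-rule {A} = ⟹E (subst (Der Δ Γ) (cong (λ X → ⌜ ∇ X ⌝ ⟹ ⌜ X ⌝) (inst-var₀ A)) (Π²E pc-rule A))

  R-principle-instance : Der Δ Γ (renPM r R-principle)
                       → (A B : Fm Δ I) → Der Δ Γ ⌜ (∇ A ⟶ ∇ B) ⟶ ∇ (A ⟶ B) ⌝
  R-principle-instance R A B =
    subst (Der Δ Γ) (cong₂ (λ X Y → ⌜ (∇ X ⟶ ∇ Y) ⟶ ∇ (X ⟶ Y) ⌝) (inst-var₀ A) (inst-var₁ B A))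
          (Π²E (Π²E R B) A)

PC-principle⊢PC-rule&R-principle : PC-principle ⊢⟨ QHC ⟩ (PC-rule & R-principle)
PC-principle⊢PC-rule&R-principle = ⟹I (⟹I (&I
  (Π²I (⟹I (let open QHC-Reasoning there (hyp (there (there (here refl))))
                open SchemaInstances there
            in mp (hyp (here refl)) (PC-principle-instance (hyp (there (here refl))) (pv here [])))))
  (Π²I (Π²I (let open QHC-Reasoning (λ x → there (there x)) (hyp (there (here refl)))
                 open SchemaInstances (λ x → there (there x))
             in PC⇒R (PC-principle-instance (hyp (here refl))) (pv here []) (pv (there here) []))))))

PC-rule&R-principle⊢PC-principle : (PC-rule & R-principle) ⊢⟨ QHC ⟩ PC-principle
PC-rule&R-principle⊢PC-principle = ⟹I (⟹I (Π²I
  (let open QHC-Reasoning there (hyp (there (here refl)))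
       open SchemaInstances there
   in PC-rule&R⇒PC (PC-rule-instance (&E₁ (hyp (here refl)))) (R-principle-instance (&E₂ (hyp (here refl))))
                   (pv here []))))

mainTheorem17 : (PC-principle ⊢⟨ QHC ⟩ (PC-rule & R-principle)) × ((PC-rule & R-principle) ⊢⟨ QHC ⟩ PC-principle)
mainTheorem17 = PC-principle⊢PC-rule&R-principle , PC-rule&R-principle⊢PC-principle
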